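{- Let $d\ge1$, $k\ge2$, $h\ge2$ be integers. There exists a constant $c=c(d,k,h)>0$ such that the following holds: for every sequence of subsets $A_n\subseteq[n]^d$ with $|A_n|=n^d-o(n^d)$ (as $n\to\infty$), for all sufficiently large $n$ and every point $v\in A_n$, $$f_{A_n}(v)\ge c\,n^{dk(h-1)}.$$
   Context: $[n]^d$ is the set of vectors in $\mathbb{Z}^d$ with all coordinates in $\{1,\dots,n\}$, with coordinatewise addition. For $A\subseteq[n]^d$ and $v\in A$, $f_A(v)$ is the number of distinct subsets $\{x_{1,i}:2\le i\le h\}\cup\{x_{\ell,i}:2\le\ell\le k,1\le i\le h\}$ of $A\setminus\{v\}$ consisting of $kh-1$ pairwise distinct points such that $v+\sum_{i=2}^h x_{1,i}=\sum_{i=1}^h x_{2,i}=\cdots=\sum_{i=1}^h x_{k,i}$. -}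

module Defs where

open import Data.Nat using (ℕ; zero; suc; _+_; _*_; _∸_; _^_; _≤_)
open import Data.Bool using (Bool; T)
open import Data.Fin using (Fin; toℕ)
open import Data.Vec using (Vec; []; _∷_; lookup; tabulate; sum)
open import Data.List using (List; []; _∷_; [_]; map; concatMap; length; filterᵇ)
open import Data.List.Membership.Propositional using (_∈_)
open import Data.List.Relation.Unary.All using (All)
open import Data.List.Relation.Unary.AllPairs using (AllPairs)
open import Data.Product using (Σ; _×_; ∃-syntax)
open import Relation.Binary.PropositionalEquality using (_≡_; _≢_)
open import Relation.Nullary using (¬_)
open import Function.Bundles using (_⇔_)

-- Coordinate value t : Fin n stands for the integer
-- toℕ t + 1 ∈ {1,…,n}.  (The defining equation of f_A has h summands on
-- each side, so the uniform shift by 1 does not affect it.)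
Point : ℕ → ℕ → Set
Point n d = Vec (Fin n) d

allPoints : (n d : ℕ) → List (Point n d)
allPoints n zero    = [ [] ]
allPoints n (suc d) =
  concatMap (λ i → map (i ∷_) (allPoints n d)) (Data.List.tabulate {n = n} (λ i → i))
  where import Data.List

SubsetOf : ℕ → ℕ → Set
SubsetOf n d = Point n d → Bool

card : {n d : ℕ} → SubsetOf n d → ℕ
card {n} {d} A = length (filterᵇ A (allPoints n d))

rowSum : {n d h : ℕ} → (Fin h → Point n d) → Fin d → ℕ
rowSum x j = sum (tabulate (λ i → toℕ (lookup (x i) j)))

-- index (ℓ,i) is the position (1,1) (0-based: (0,0)), occupied by v
IsFirst : {k h : ℕ} → Fin k → Fin h → Set
IsFirst ℓ i = (toℕ ℓ ≡ 0) × (toℕ i ≡ 0)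

-- S (a finite set of points, given as a list) is one of the subsets counted
-- by f_A(v): S ⊆ A \ {v}, and there is a labelling x_{ℓ,i} (ℓ ∈ [k], i ∈ [h])
-- with x_{1,1} = v, the kh−1 points x_{ℓ,i}, (ℓ,i) ≠ (1,1), pairwise
-- distinct and forming exactly the set S, and
-- Σ_i x_{1,i} = Σ_i x_{ℓ,i} for all ℓ (coordinatewise).
GoodSet : (k h : ℕ) {n d : ℕ} → SubsetOf n d → Point n d → List (Point n d) → Set
GoodSet k h {n} {d} A v S =
  All (λ p → T (A p) × p ≢ v) S
  × Σ (Fin k → Fin h → Point n d) λ x →
      (∀ ℓ i → IsFirst ℓ i → x ℓ i ≡ v)
    × (∀ ℓ i ℓ′ i′ → ¬ IsFirst ℓ i → ¬ IsFirst ℓ′ i′ →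
         x ℓ i ≡ x ℓ′ i′ → (ℓ ≡ ℓ′) × (i ≡ i′))
    × (∀ p → (p ∈ S) ⇔ (∃[ ℓ ] ∃[ i ] (¬ IsFirst ℓ i × x ℓ i ≡ p)))
    × (∀ ℓ ℓ′ j → rowSum (x ℓ) j ≡ rowSum (x ℓ′) j)

DifferentSets : {n d : ℕ} → List (Point n d) → List (Point n d) → Set
DifferentSets S S′ = ¬ (∀ p → (p ∈ S) ⇔ (p ∈ S′))

fAtLeast : (k h : ℕ) {n d : ℕ} → SubsetOf n d → Point n d → ℕ → Set
fAtLeast k h {n} {d} A v m =
  Σ (List (List (Point n d))) λ Ss →
    All (GoodSet k h A v) Ss × AllPairs DifferentSets Ss × (m ≤ length Ss)

-- |A_n| = n^d − o(n^d):  for every m ≥ 1, eventually m·(n^d − |A_n|) ≤ n^d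
-- (i.e. n^d − |A_n| ≤ n^d / m for all large n).
AlmostFull : (d : ℕ) → ((n : ℕ) → SubsetOf n d) → Set
AlmostFull d A =
  ∀ (m : ℕ) → 1 ≤ m → ∃[ N ] ∀ (n : ℕ) → N ≤ n → m * (n ^ d ∸ card (A n)) ≤ n ^ d

module Submission where

-- Reflecting a coordinate, u ↦ (n − 1) − u, changes every h-term row sum by the same amount,
-- so we may assume that each coordinate of v lies in the upper half of {0, …, n − 1}.
-- Take boxes of side w ≈ n / K. The k(h − 1) points x_{ℓ,i} with i ≥ 2 are chosen freely,
-- each from its own translate of [0, w)^d near the origin; the first point of every row
-- ℓ ≥ 2 is then forced: x_{ℓ,1} = v + Σ_{i≥2} x_{1,i} − Σ_{i≥2} x_{ℓ,i}. The translates are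
-- spaced so that the forced points of different rows fall into disjoint bands below v and
-- above all the boxes; thus the first coordinate of a point already tells its position, so
-- the kh points are distinct and different choices give different sets. The forced point
-- of a row depends injectively on the first free point of that row, hence each free point
-- loses at most 2 |[n]^d ∖ A| of its w^d choices to points outside A. As |[n]^d ∖ A| is
-- o(n^d), at least w^d / 2 choices remain, which gives (w^d / 2)^{k(h−1)} ≥ c n^{dk(h−1)}
-- sets.

open import Level using (Level)
open import Algebra.Properties.CommutativeSemigroup using (interchange; x∙yz≈xz∙y; x∙yz≈y∙xz)
open import Data.Bool using (Bool; true; false; not; T)
open import Data.Fin using (Fin; toℕ; combine) renaming (zero to fzero; suc to fsuc)
open import Data.Fin.Properties
  using (toℕ<n; toℕ-injective; toℕ-fromℕ<; toℕ-combine; combine-injective)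
open import Data.List
  using (List; []; _∷_; [_]; _++_; map; concatMap; length; filter; filterᵇ; tabulate; allFin)
open import Data.List.Properties using (length-++; length-map; length-tabulate)
open import Data.List.Membership.Propositional using (_∈_; lose; find)
open import Data.List.Membership.Propositional.Properties
open import Data.List.Relation.Binary.Subset.Propositional using (_⊆_)
open import Data.List.Relation.Unary.Any using (here; there)
import Data.List.Relation.Unary.All as All
import Data.List.Relation.Unary.All.Properties as All
open import Data.List.Relation.Unary.AllPairs as AllPairs using ([]; _∷_)
import Data.List.Relation.Unary.AllPairs.Properties as AllPairs
open import Data.List.Relation.Unary.Unique.Propositional using (Unique)
import Data.List.Relation.Unary.Unique.Propositional.Properties as Unique
open import Data.Nat
  using ( ℕ; zero; suc; _+_; _*_; _∸_; _^_; _≤_; _<_; _≤ᵇ_; _≟_; z≤n; s≤s; s≤s⁻¹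
        ; NonZero; >-nonZero; _/_; _%_)
open import Data.Nat.DivMod
  using (_mod_; m<n⇒m%n≡m; m≡m%n+[m/n]*n; m%n<n; m/n*n≤m; m≥n⇒m/n>0)
open import Data.Nat.Properties
open import Data.Nat.Tactic.RingSolver using (solve-∀)
open import Data.Product using (_×_; _,_; proj₁; proj₂; ∃-syntax; swap)
open import Data.Sum using (inj₁; inj₂)
open import Data.Vec as Vec using (Vec; []; _∷_; lookup)
open import Data.Vec.Properties using (lookup∘tabulate; ∷-injective)
open import Data.Vec.Relation.Binary.Pointwise.Extensional using (ext; Pointwise-≡⇒≡)
open import Function using (_∘_; id)
open import Function.Bundles using (_⇔_; mk⇔; Equivalence)
open import Function.Definitions using (Injective)
open import Relation.Binary.Definitions using (tri<; tri≈; tri>)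
open import Relation.Binary.PropositionalEquality hiding ([_])
open import Relation.Nullary using (¬_; Dec; ¬?; _×-dec_)
open import Relation.Nullary.Decidable using (T?)
open import Relation.Nullary.Negation using (contradiction)
open import Defs

private variable
  α β γ : Level
  A B C : Set α

-- Dependent products of lists

module _ (g : A → B → C) where

  dependentProductWith : List A → (A → List B) → List C
  dependentProductWith xs f = concatMap (λ x → map (g x) (f x)) xs

  ∈-dependentProductWith⁺ : ∀ {xs f x y} → x ∈ xs → y ∈ f x → g x y ∈ dependentProductWith xs f
  ∈-dependentProductWith⁺ {f = f} x∈xs y∈fx =
    ∈-concatMap⁺ (λ x → map (g x) (f x)) (lose x∈xs (∈-map⁺ (g _) y∈fx))

  ∈-dependentProductWith⁻ : ∀ xs f {z} → z ∈ dependentProductWith xs f →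
                            ∃[ x ] ∃[ y ] (x ∈ xs × y ∈ f x × z ≡ g x y)
  ∈-dependentProductWith⁻ xs f z∈ with find (∈-concatMap⁻ (λ x → map (g x) (f x)) {xs} z∈)
  ... | x , x∈xs , z∈gx with ∈-map⁻ (g x) z∈gx
  ...   | y , y∈fx , refl = x , y , x∈xs , y∈fx , refl

  length-dependentProductWith : ∀ xs f {L} → (∀ x → length (f x) ≡ L) →
                                length (dependentProductWith xs f) ≡ length xs * L
  length-dependentProductWith []       f eq = refl
  length-dependentProductWith (x ∷ xs) f {L} eq = begin
    length (map (g x) (f x) ++ dependentProductWith xs f)
      ≡⟨ length-++ (map (g x) (f x)) ⟩
    length (map (g x) (f x)) + length (dependentProductWith xs f)
      ≡⟨ cong₂ _+_ (trans (length-map (g x) (f x)) (eq x)) (length-dependentProductWith xs f eq) ⟩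
    L + length xs * L ∎
    where open ≡-Reasoning

  length-dependentProductWith-≥ : ∀ xs f {L} → (∀ {x} → x ∈ xs → L ≤ length (f x)) →
                                  length xs * L ≤ length (dependentProductWith xs f)
  length-dependentProductWith-≥ []       f le = z≤n
  length-dependentProductWith-≥ (x ∷ xs) f {L} le = begin
    L + length xs * L
      ≤⟨ +-mono-≤ (le (here refl)) (length-dependentProductWith-≥ xs f (le ∘ there)) ⟩
    length (f x) + length (dependentProductWith xs f)
      ≡⟨ cong (_+ _) (length-map (g x) (f x)) ⟨
    length (map (g x) (f x)) + length (dependentProductWith xs f)
      ≡⟨ length-++ (map (g x) (f x)) ⟨
    length (map (g x) (f x) ++ dependentProductWith xs f) ∎
    where open ≤-Reasoning

  dependentProductWith⁺ : (∀ {x x′ y y′} → g x y ≡ g x′ y′ → x ≡ x′ × y ≡ y′) →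
                          ∀ {xs f} → Unique xs → (∀ x → Unique (f x)) →
                          Unique (dependentProductWith xs f)
  dependentProductWith⁺ g-inj {xs} {f} xs! f! = Unique.concat⁺
    (All.map⁺ (All.tabulate λ {x} _ → Unique.map⁺ (proj₂ ∘ g-inj) (f! x)))
    (AllPairs.map⁺ (AllPairs.map disjoint xs!))
    where
    disjoint : ∀ {x x′} → x ≢ x′ → ∀ {z} → ¬ (z ∈ map (g x) (f x) × z ∈ map (g x′) (f x′))
    disjoint x≢x′ (z∈ , z∈′) with ∈-map⁻ (g _) z∈ | ∈-map⁻ (g _) z∈′
    ... | _ , _ , refl | _ , _ , eq = x≢x′ (proj₁ (g-inj eq))

choices : ∀ {m} → (Fin m → List A) → List (Vec A m)
choices {m = zero}  f = [ [] ]
choices {m = suc m} f = dependentProductWith Vec._∷_ (f fzero) (λ _ → choices (f ∘ fsuc))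

∈-choices⁻ : ∀ {m} (f : Fin m → List A) {r} → r ∈ choices f → ∀ i → lookup r i ∈ f i
∈-choices⁻ {m = suc m} f r∈ i with ∈-dependentProductWith⁻ Vec._∷_ (f fzero) _ r∈
∈-choices⁻ {m = suc m} f r∈ fzero    | x , r , x∈ , r∈′ , refl = x∈
∈-choices⁻ {m = suc m} f r∈ (fsuc i) | x , r , x∈ , r∈′ , refl = ∈-choices⁻ (f ∘ fsuc) r∈′ i

length-choices-≥ : ∀ {m} (f : Fin m → List A) {L} → (∀ i → L ≤ length (f i)) →
                   L ^ m ≤ length (choices f)
length-choices-≥ {m = zero}  f le = ≤-refl
length-choices-≥ {m = suc m} f {L} le = begin
  L * L ^ m                 ≤⟨ *-monoˡ-≤ (L ^ m) (le fzero) ⟩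
  length (f fzero) * L ^ m  ≤⟨ length-dependentProductWith-≥ Vec._∷_ (f fzero) _
                                 (λ _ → length-choices-≥ (f ∘ fsuc) (le ∘ fsuc)) ⟩
  length (choices f)        ∎
  where open ≤-Reasoning

choices⁺ : ∀ {m} {f : Fin m → List A} → (∀ i → Unique (f i)) → Unique (choices f)
choices⁺ {m = zero}  f! = All.[] ∷ []
choices⁺ {m = suc m} f! =
  dependentProductWith⁺ Vec._∷_ ∷-injective (f! fzero) (λ _ → choices⁺ (f! ∘ fsuc))

∈-allPoints : ∀ {n d} (p : Point n d) → p ∈ allPoints n d
∈-allPoints []      = here refl
∈-allPoints (i ∷ p) = ∈-dependentProductWith⁺ Vec._∷_ (∈-tabulate⁺ i) (∈-allPoints p)

allPoints⁺ : ∀ {n} d → Unique (allPoints n d)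
allPoints⁺ zero    = All.[] ∷ []
allPoints⁺ (suc d) =
  dependentProductWith⁺ Vec._∷_ ∷-injective (Unique.tabulate⁺ id) (λ _ → allPoints⁺ d)

length-allPoints : ∀ n d → length (allPoints n d) ≡ n ^ d
length-allPoints n zero    = refl
length-allPoints n (suc d) = trans
  (length-dependentProductWith Vec._∷_ (tabulate {n = n} id) (λ _ → allPoints n d)
     (λ _ → length-allPoints n d))
  (cong (_* n ^ d) (length-tabulate {n = n} id))

-- Counting points outside A

length-filterᵇ-split : ∀ (p : A → Bool) xs →
                       length xs ≡ length (filterᵇ p xs) + length (filterᵇ (not ∘ p) xs)
length-filterᵇ-split p []       = refl
length-filterᵇ-split p (x ∷ xs) with p x
... | true  = cong suc (length-filterᵇ-split p xs)
... | false = trans (cong suc (length-filterᵇ-split p xs)) (sym (+-suc _ _))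

Unique-⊆⇒length≤ : ∀ {xs ys : List A} → Unique xs → xs ⊆ ys → length xs ≤ length ys
Unique-⊆⇒length≤ {xs = []}     _            _     = z≤n
Unique-⊆⇒length≤ {xs = x ∷ xs} (x∉xs ∷ xs!) xs⊆ys with ∈-∃++ (xs⊆ys (here refl))
... | us , vs , refl = begin
  suc (length xs)              ≤⟨ s≤s (Unique-⊆⇒length≤ xs! xs⊆us++vs) ⟩
  suc (length (us ++ vs))      ≡⟨ cong suc (length-++ us) ⟩
  suc (length us + length vs)  ≡⟨ +-suc (length us) (length vs) ⟨
  length us + length (x ∷ vs)  ≡⟨ length-++ us ⟨
  length (us ++ x ∷ vs)        ∎
  where
  open ≤-Reasoning
  xs⊆us++vs : xs ⊆ us ++ vs
  xs⊆us++vs {z} z∈xs with ∈-++⁻ us (xs⊆ys (there z∈xs))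
  ... | inj₁ z∈us         = ∈-++⁺ˡ z∈us
  ... | inj₂ (here refl)  = contradiction refl (All.lookup x∉xs z∈xs)
  ... | inj₂ (there z∈vs) = ∈-++⁺ʳ us z∈vs

missing : ∀ {n d} → SubsetOf n d → ℕ
missing {n} {d} A = length (filterᵇ (not ∘ A) (allPoints n d))

missing≡ : ∀ {n d} (A : SubsetOf n d) → missing A ≡ n ^ d ∸ card A
missing≡ {n} {d} A = begin
  missing A                        ≡⟨ m+n∸m≡n (card A) (missing A) ⟨
  card A + missing A ∸ card A      ≡⟨ cong (_∸ card A) (length-filterᵇ-split A (allPoints n d)) ⟨
  length (allPoints n d) ∸ card A  ≡⟨ cong (_∸ card A) (length-allPoints n d) ⟩
  n ^ d ∸ card A                   ∎
  where open ≡-Reasoning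

length-filterᵇ-∘-injective : ∀ {n d} (A : SubsetOf n d) {F : B → Point n d} →
                             Injective _≡_ _≡_ F → ∀ {xs} → Unique xs →
                             length xs ∸ missing A ≤ length (filterᵇ (A ∘ F) xs)
length-filterᵇ-∘-injective A {F} F-inj {xs} xs! = begin
  length xs ∸ missing A
    ≤⟨ ∸-monoʳ-≤ (length xs) outside≤missing ⟩
  length xs ∸ length outside
    ≡⟨ cong (_∸ length outside) (length-filterᵇ-split (A ∘ F) xs) ⟩
  length inside + length outside ∸ length outside
    ≡⟨ m+n∸n≡m (length inside) (length outside) ⟩
  length inside ∎
  where
  open ≤-Reasoning
  inside  = filterᵇ (A ∘ F) xs
  outside = filterᵇ (not ∘ A ∘ F) xs
  F[outside]⊆Aᶜ : map F outside ⊆ filterᵇ (not ∘ A) (allPoints _ _)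
  F[outside]⊆Aᶜ p∈ with ∈-map⁻ F p∈
  ... | t , t∈ , refl = ∈-filter⁺ (T? ∘ not ∘ A) (∈-allPoints (F t))
                          (proj₂ (∈-filter⁻ (T? ∘ not ∘ A ∘ F) {xs = xs} t∈))
  outside≤missing : length outside ≤ missing A
  outside≤missing = begin
    length outside          ≡⟨ length-map F outside ⟨
    length (map F outside)  ≤⟨ Unique-⊆⇒length≤
                                 (Unique.map⁺ F-inj (Unique.filter⁺ (T? ∘ not ∘ A ∘ F) xs!))
                                 F[outside]⊆Aᶜ ⟩
    missing A               ∎

-- Finite sums and reflection

∑ : ∀ {m} → (Fin m → ℕ) → ℕ
∑ f = Vec.sum (Vec.tabulate f)

∑-cong : ∀ {m} {f g : Fin m → ℕ} → (∀ i → f i ≡ g i) → ∑ f ≡ ∑ g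
∑-cong {m = zero}  eq = refl
∑-cong {m = suc m} eq = cong₂ _+_ (eq fzero) (∑-cong (eq ∘ fsuc))

∑-distrib-+ : ∀ {m} (f g : Fin m → ℕ) → ∑ (λ i → f i + g i) ≡ ∑ f + ∑ g
∑-distrib-+ {m = zero}  f g = refl
∑-distrib-+ {m = suc m} f g = begin
  f fzero + g fzero + ∑ (λ i → f (fsuc i) + g (fsuc i))
    ≡⟨ cong (f fzero + g fzero +_) (∑-distrib-+ (f ∘ fsuc) (g ∘ fsuc)) ⟩
  f fzero + g fzero + (∑ (f ∘ fsuc) + ∑ (g ∘ fsuc))
    ≡⟨ interchange +-commutativeSemigroup (f fzero) (g fzero) (∑ (f ∘ fsuc)) (∑ (g ∘ fsuc)) ⟩
  f fzero + ∑ (f ∘ fsuc) + (g fzero + ∑ (g ∘ fsuc)) ∎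
  where open ≡-Reasoning

∑-const : ∀ m c → ∑ {m} (λ _ → c) ≡ m * c
∑-const zero    c = refl
∑-const (suc m) c = cong (c +_) (∑-const m c)

∑-≤ : ∀ {m} (f : Fin m → ℕ) {c} → (∀ i → f i ≤ c) → ∑ f ≤ m * c
∑-≤ {m = zero}  f le = z≤n
∑-≤ {m = suc m} f le = +-mono-≤ (le fzero) (∑-≤ (f ∘ fsuc) (le ∘ fsuc))

∑-∸ : ∀ {m} (f : Fin m → ℕ) {c} → (∀ i → f i ≤ c) → ∑ (λ i → c ∸ f i) + ∑ f ≡ m * c
∑-∸ {m = m} f {c} le = begin
  ∑ (λ i → c ∸ f i) + ∑ f  ≡⟨ ∑-distrib-+ (λ i → c ∸ f i) f ⟨
  ∑ (λ i → c ∸ f i + f i)  ≡⟨ ∑-cong (λ i → m∸n+n≡m (le i)) ⟩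
  ∑ {m} (λ _ → c)          ≡⟨ ∑-const m c ⟩
  m * c                    ∎
  where open ≡-Reasoning

mirror : ℕ → Bool → ℕ → ℕ
mirror m true  u = u
mirror m false u = m ∸ u

mirror-≤ : ∀ {m} b {u} → u ≤ m → mirror m b u ≤ m
mirror-≤     true        u≤m = u≤m
mirror-≤ {m} false {u} _   = m∸n≤m m u

mirror-involutive : ∀ {m} b {u} → u ≤ m → mirror m b (mirror m b u) ≡ u
mirror-involutive true  _   = refl
mirror-involutive false u≤m = m∸[m∸n]≡n u≤m

∑-mirror : ∀ {m h} b (f g : Fin h → ℕ) → (∀ i → f i ≤ m) → (∀ i → g i ≤ m) →
           ∑ f ≡ ∑ g → ∑ (mirror m b ∘ f) ≡ ∑ (mirror m b ∘ g)
∑-mirror true  f g _ _ eq = eq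
∑-mirror {m} {h} false f g f≤m g≤m eq = +-cancelʳ-≡ (∑ f) _ _ (begin
  ∑ (λ i → m ∸ f i) + ∑ f  ≡⟨ ∑-∸ f f≤m ⟩
  h * m                    ≡⟨ ∑-∸ g g≤m ⟨
  ∑ (λ i → m ∸ g i) + ∑ g  ≡⟨ cong (∑ (λ i → m ∸ g i) +_) eq ⟨
  ∑ (λ i → m ∸ g i) + ∑ f  ∎)
  where open ≡-Reasoning

upperHalf : ℕ → ℕ → Bool
upperHalf m u = m ∸ u ≤ᵇ u

mirror-upperHalf : ∀ {m u} → u ≤ m → let u′ = mirror m (upperHalf m u) u in m ∸ u′ ≤ u′
mirror-upperHalf {m} {u} u≤m with m ∸ u ≤ᵇ u in eq
... | true  = ≤ᵇ⇒≤ (m ∸ u) u (subst T (sym eq) _)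
... | false = subst (_≤ m ∸ u) (sym (m∸[m∸n]≡n u≤m))
                (<⇒≤ (≰⇒> λ m∸u≤u → subst T eq (≤⇒≤ᵇ m∸u≤u)))

upperHalf-≥ : ∀ {m u R} → m ∸ u ≤ u → 2 * R ≤ suc m → R ≤ u
upperHalf-≥ {m} {u} {R} m∸u≤u 2R≤1+m = ≮⇒≥ λ u<R → <-irrefl refl (begin-strict
  2 * R          ≤⟨ 2R≤1+m ⟩
  suc m          ≤⟨ s≤s (≤-trans (m≤n+m∸n m u) (+-monoʳ-≤ u m∸u≤u)) ⟩
  suc (u + u)    <⟨ s≤s (+-monoʳ-< u (n<1+n u)) ⟩
  suc u + suc u  ≤⟨ +-mono-≤ u<R u<R ⟩
  R + R          ≡⟨ cong (R +_) (+-identityʳ R) ⟨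
  2 * R          ∎)
  where open ≤-Reasoning

m*n+o<p*n : ∀ {m n o p} → m < p → o < n → m * n + o < p * n
m*n+o<p*n {m} {n} {o} {p} m<p o<n = begin-strict
  m * n + o  <⟨ +-monoʳ-< (m * n) o<n ⟩
  m * n + n  ≡⟨ +-comm (m * n) n ⟩
  suc m * n  ≤⟨ *-monoˡ-≤ n m<p ⟩
  p * n      ∎
  where open ≤-Reasoning

m*n+o≡p*n+q⇒m≡p : ∀ {m n o p q} → o < n → q < n → m * n + o ≡ p * n + q → m ≡ p
m*n+o≡p*n+q⇒m≡p {m} {n} {o} {p} {q} o<n q<n eq with <-cmp m p
... | tri< m<p _ _ = contradiction eq (<⇒≢ (<-≤-trans (m*n+o<p*n m<p o<n) (m≤m+n (p * n) q)))
... | tri≈ _ m≡p _ = m≡p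
... | tri> _ _ p<m = contradiction (sym eq) (<⇒≢ (<-≤-trans (m*n+o<p*n p<m q<n) (m≤m+n (m * n) o)))

+-cancel-cross : ∀ y a m m′ t t′ s s′ → y + m + t ≡ a + s → y + m′ + t′ ≡ a + s′ →
                 m + (t + s′) ≡ m′ + (t′ + s)
+-cancel-cross y a m m′ t t′ s s′ eq eq′ = +-cancelˡ-≡ y _ _ (begin
  y + (m + (t + s′))   ≡⟨ reassoc y m t s′ ⟩
  y + m + t + s′       ≡⟨ cong (_+ s′) eq ⟩
  a + s + s′           ≡⟨ +-assoc a s s′ ⟩
  a + (s + s′)         ≡⟨ cong (a +_) (+-comm s s′) ⟩
  a + (s′ + s)         ≡⟨ +-assoc a s′ s ⟨
  a + s′ + s           ≡⟨ cong (_+ s) eq′ ⟨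
  y + m′ + t′ + s      ≡⟨ reassoc y m′ t′ s ⟨
  y + (m′ + (t′ + s))  ∎)
  where
  open ≡-Reasoning
  reassoc : ∀ y m t s → y + (m + (t + s)) ≡ y + m + t + s
  reassoc = solve-∀

^-distribʳ-* : ∀ m n o → (m * n) ^ o ≡ m ^ o * n ^ o
^-distribʳ-* m n zero    = refl
^-distribʳ-* m n (suc o) =
  trans (cong (m * n *_) (^-distribʳ-* m n o)) (interchange *-commutativeSemigroup m n (m ^ o) (n ^ o))

n≤m⇒m≤2*n*[m/n] : ∀ m n .{{_ : NonZero n}} → n ≤ m → m ≤ 2 * n * (m / n)
n≤m⇒m≤2*n*[m/n] m n n≤m = begin
  m                        ≡⟨ m≡m%n+[m/n]*n m n ⟩
  m % n + m / n * n        ≤⟨ +-monoˡ-≤ (m / n * n) (≤-trans (<⇒≤ (m%n<n m n)) (m≤m*n n (m / n))) ⟩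
  n * (m / n) + m / n * n  ≡⟨ double n (m / n) ⟩
  2 * n * (m / n)          ∎
  where
  open ≤-Reasoning
  instance _ = >-nonZero (m≥n⇒m/n>0 n≤m)
  double : ∀ n q → n * q + q * n ≡ 2 * n * q
  double = solve-∀

power-bound : ∀ {x W M Q} e → x ≤ Q * W → 4 * M ≤ W → x ^ e ≤ (Q * 2) ^ e * (W ∸ (M + M)) ^ e
power-bound {x} {W} {M} {Q} e x≤QW 4M≤W = begin
  x ^ e                            ≤⟨ ^-monoˡ-≤ e (≤-trans x≤QW (*-monoʳ-≤ Q W≤2L)) ⟩
  (Q * (2 * (W ∸ (M + M)))) ^ e    ≡⟨ cong (_^ e) (*-assoc Q 2 _) ⟨
  (Q * 2 * (W ∸ (M + M))) ^ e      ≡⟨ ^-distribʳ-* (Q * 2) (W ∸ (M + M)) e ⟩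
  (Q * 2) ^ e * (W ∸ (M + M)) ^ e  ∎
  where
  open ≤-Reasoning
  W≤2L : W ≤ 2 * (W ∸ (M + M))
  W≤2L with m≤n⇒∃[o]m+o≡n 4M≤W
  ... | c , refl = begin
    4 * M + c                            ≤⟨ m≤m+n (4 * M + c) c ⟩
    4 * M + c + c                        ≡⟨ twice M c ⟩
    2 * (M + M + c)                      ≡⟨ cong (2 *_) (m+n∸m≡n (M + M) (M + M + c)) ⟨
    2 * (M + M + (M + M + c) ∸ (M + M))  ≡⟨ cong (λ z → 2 * (z ∸ (M + M))) (regroup M c) ⟩
    2 * (4 * M + c ∸ (M + M))            ∎
    where
    twice : ∀ M c → 4 * M + c + c ≡ 2 * (M + M + c)
    twice = solve-∀
    regroup : ∀ M c → M + M + (M + M + c) ≡ 4 * M + c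
    regroup = solve-∀

-- Labellings and the sets they span

isFirst? : ∀ {k h} (ℓ : Fin k) (i : Fin h) → Dec (IsFirst ℓ i)
isFirst? ℓ i = (toℕ ℓ ≟ 0) ×-dec (toℕ i ≟ 0)

nonFirstPoints : ∀ {k h} → (Fin k → Fin h → A) → List A
nonFirstPoints {k = k} {h} x =
  dependentProductWith x (allFin k) (λ ℓ → filter (¬? ∘ isFirst? ℓ) (allFin h))

∈-nonFirstPoints : ∀ {k h} (x : Fin k → Fin h → A) {p} →
                   (p ∈ nonFirstPoints x) ⇔ (∃[ ℓ ] ∃[ i ] (¬ IsFirst ℓ i × x ℓ i ≡ p))
∈-nonFirstPoints {k = k} {h} x = mk⇔ to from
  where
  to : ∀ {p} → p ∈ nonFirstPoints x → ∃[ ℓ ] ∃[ i ] (¬ IsFirst ℓ i × x ℓ i ≡ p)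
  to p∈ with ∈-dependentProductWith⁻ x (allFin k) _ p∈
  ... | ℓ , i , _ , i∈ , refl = ℓ , i , proj₂ (∈-filter⁻ (¬? ∘ isFirst? ℓ) {xs = allFin h} i∈) , refl
  from : ∀ {p} → ∃[ ℓ ] ∃[ i ] (¬ IsFirst ℓ i × x ℓ i ≡ p) → p ∈ nonFirstPoints x
  from (ℓ , i , ¬first , refl) =
    ∈-dependentProductWith⁺ x (∈-allFin ℓ) (∈-filter⁺ (¬? ∘ isFirst? ℓ) (∈-allFin i) ¬first)

-- The construction

layoutFactor : ℕ → ℕ → ℕ
layoutFactor k H = 6 * (k * (H * suc H))

module Construction
  {n₀ d₀ k′ H₀ : ℕ} (A : SubsetOf (suc n₀) (suc d₀)) (v : Point (suc n₀) (suc d₀))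
  {w : ℕ} (1≤w : 1 ≤ w) (w*K≤n : w * layoutFactor (suc k′) (suc H₀) ≤ suc n₀)
  where

  n d k H h : ℕ
  n = suc n₀
  d = suc d₀
  k = suc k′
  H = suc H₀
  h = suc H

  orientation : Fin d → Bool
  orientation j = upperHalf n₀ (toℕ (lookup v j))

  μ : Fin d → ℕ → ℕ
  μ j = mirror n₀ (orientation j)

  a : Fin d → ℕ
  a j = μ j (toℕ (lookup v j))

  -- `mod n` only makes toPoint total; it is never applied to a value ≥ n.
  opaque
    toPoint : (Fin d → ℕ) → Point n d
    toPoint o = Vec.tabulate (λ j → μ j (o j) mod n)

    toℕ-toPoint : ∀ o j → o j < n → toℕ (lookup (toPoint o) j) ≡ μ j (o j)
    toℕ-toPoint o j o<n = begin
      toℕ (lookup (toPoint o) j)  ≡⟨ cong toℕ (lookup∘tabulate (λ j → μ j (o j) mod n) j) ⟩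
      toℕ (μ j (o j) mod n)       ≡⟨ toℕ-fromℕ< _ ⟩
      μ j (o j) % n               ≡⟨ m<n⇒m%n≡m (s≤s (mirror-≤ (orientation j) (s≤s⁻¹ o<n))) ⟩
      μ j (o j)                   ∎
      where open ≡-Reasoning

  toPoint-injective : ∀ o o′ j → o j < n → o′ j < n → toPoint o ≡ toPoint o′ → o j ≡ o′ j
  toPoint-injective o o′ j o<n o′<n eq = begin
    o j                                ≡⟨ mirror-involutive (orientation j) (s≤s⁻¹ o<n) ⟨
    μ j (μ j (o j))                    ≡⟨ cong (μ j) (toℕ-toPoint o j o<n) ⟨
    μ j (toℕ (lookup (toPoint o) j))   ≡⟨ cong (λ p → μ j (toℕ (lookup p j))) eq ⟩
    μ j (toℕ (lookup (toPoint o′) j))  ≡⟨ cong (μ j) (toℕ-toPoint o′ j o′<n) ⟩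
    μ j (μ j (o′ j))                   ≡⟨ mirror-involutive (orientation j) (s≤s⁻¹ o′<n) ⟩
    o′ j                               ∎
    where open ≡-Reasoning

  a<n : ∀ j → a j < n
  a<n j = s≤s (mirror-≤ (orientation j) (s≤s⁻¹ (toℕ<n (lookup v j))))

  toPoint-a : toPoint a ≡ v
  toPoint-a = Pointwise-≡⇒≡ (ext λ j → toℕ-injective (trans (toℕ-toPoint a j (a<n j))
    (mirror-involutive (orientation j) (s≤s⁻¹ (toℕ<n (lookup v j))))))

  -- The free point (ℓ, i) lives in the cell [c U, c U + w)^d, c = combine ℓ i. The free sums
  -- of consecutive rows then differ by Z = H²U, and Z > 2Hw keeps the forced points of
  -- different rows apart.
  U Z : ℕ
  U = 3 * w
  Z = H * (H * U)

  a-large : ∀ j → 3 * w * (k * (H * h)) ≤ a j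
  a-large j = upperHalf-≥ (mirror-upperHalf (s≤s⁻¹ (toℕ<n (lookup v j))))
    (≤-trans (≤-reflexive (double w k H)) w*K≤n)
    where
    double : ∀ w k H → 2 * (3 * w * (k * (H * suc H))) ≡ w * (6 * (k * (H * suc H)))
    double = solve-∀

  2Hw<Z : H * w + H * w < Z
  2Hw<Z = begin-strict
    H * w + H * w          <⟨ m<m+n (H * w + H * w) (*-mono-≤ {1} {H} (s≤s z≤n) 1≤w) ⟩
    H * w + H * w + H * w  ≡⟨ triple H w ⟩
    H * U                  ≤⟨ m≤n*m (H * U) H ⟩
    Z                      ∎
    where
    open ≤-Reasoning
    triple : ∀ H w → H * w + H * w + H * w ≡ H * (3 * w)
    triple = solve-∀

  Hw<Z : H * w < Z
  Hw<Z = ≤-<-trans (m≤m+n (H * w) (H * w)) 2Hw<Z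

  room : ∀ j → k * H * U + (k′ * Z + H * w) ≤ a j
  room j = begin
    k * H * U + (k′ * Z + H * w)
      ≤⟨ +-monoʳ-≤ (k * H * U) (+-monoʳ-≤ (k′ * Z) (<⇒≤ Hw<Z)) ⟩
    k * H * U + (k′ * Z + Z)  ≡⟨ layout-size k′ H w ⟩
    3 * w * (k * (H * h))     ≤⟨ a-large j ⟩
    a j                       ∎
    where
    open ≤-Reasoning
    layout-size : ∀ k′ H w → suc k′ * H * (3 * w) + (k′ * (H * (H * (3 * w))) + H * (H * (3 * w)))
                             ≡ 3 * w * (suc k′ * (H * suc H))
    layout-size = solve-∀

  Box Row Cfg : Set
  Box = Point w d
  Row = Vec Box H
  Cfg = Vec Row k

  free : Fin k → Fin H → Box → Fin d → ℕ
  free ℓ i t j = toℕ (combine ℓ i) * U + toℕ (lookup t j)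

  offset<U : ∀ (t : Box) j → toℕ (lookup t j) < U
  offset<U t j = ≤-trans (toℕ<n (lookup t j)) (m≤n*m w 3)

  free<kHU : ∀ ℓ i t j → free ℓ i t j < k * H * U
  free<kHU ℓ i t j = m*n+o<p*n (toℕ<n (combine ℓ i)) (offset<U t j)

  free<n : ∀ ℓ i t j → free ℓ i t j < n
  free<n ℓ i t j = <-≤-trans (free<kHU ℓ i t j) (≤-trans (m≤m+n _ _) (≤-trans (room j) (<⇒≤ (a<n j))))

  free-injective : ∀ ℓ i t t′ j → free ℓ i t j ≡ free ℓ i t′ j → lookup t j ≡ lookup t′ j
  free-injective ℓ i t t′ j eq = toℕ-injective (+-cancelˡ-≡ (toℕ (combine ℓ i) * U) _ _ eq)

  Σfree : Fin k → Row → Fin d → ℕ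
  Σfree ℓ r j = ∑ (λ i → free ℓ i (lookup r i) j)

  Σoffsets : Row → Fin d → ℕ
  Σoffsets r j = ∑ (λ i → toℕ (lookup (lookup r i) j))

  Σoffsets≤ : ∀ r j → Σoffsets r j ≤ H * w
  Σoffsets≤ r j = ∑-≤ _ (λ i → <⇒≤ (toℕ<n (lookup (lookup r i) j)))

  E : ℕ
  E = ∑ {H} (λ i → toℕ i * U)

  Σfree≡ : ∀ ℓ r j → Σfree ℓ r j ≡ toℕ ℓ * Z + (E + Σoffsets r j)
  Σfree≡ ℓ r j = begin
    Σfree ℓ r j
      ≡⟨ ∑-cong (λ i → trans (cong (λ c → c * U + offset i) (toℕ-combine ℓ i))
                             (split H U (toℕ ℓ) (toℕ i) (offset i))) ⟩
    ∑ (λ i → toℕ ℓ * (H * U) + (toℕ i * U + offset i))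
      ≡⟨ ∑-distrib-+ (λ _ → toℕ ℓ * (H * U)) (λ i → toℕ i * U + offset i) ⟩
    ∑ {H} (λ _ → toℕ ℓ * (H * U)) + ∑ (λ i → toℕ i * U + offset i)
      ≡⟨ cong₂ _+_ (trans (∑-const H _) (rows (toℕ ℓ) H U))
                   (∑-distrib-+ (λ i → toℕ i * U) offset) ⟩
    toℕ ℓ * Z + (E + Σoffsets r j) ∎
    where
    open ≡-Reasoning
    offset : Fin H → ℕ
    offset i = toℕ (lookup (lookup r i) j)
    split : ∀ H U l i o → (H * l + i) * U + o ≡ l * (H * U) + (i * U + o)
    split = solve-∀
    rows : ∀ l H U → H * (l * (H * U)) ≡ l * (H * (H * U))
    rows = solve-∀

  -- The subtraction never truncates, by Σfree≤.
  closing : Fin k′ → Row → Row → Fin d → ℕ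
  closing ℓ′ r₀ r j = a j + Σfree fzero r₀ j ∸ Σfree (fsuc ℓ′) r j

  Σfree≤ : ∀ ℓ′ r₀ r j → Σfree (fsuc ℓ′) r j ≤ a j + Σfree fzero r₀ j
  Σfree≤ ℓ′ r₀ r j = begin
    Σfree (fsuc ℓ′) r j
      ≡⟨ Σfree≡ (fsuc ℓ′) r j ⟩
    toℕ (fsuc ℓ′) * Z + (E + Σoffsets r j)
      ≤⟨ +-mono-≤ (*-monoˡ-≤ Z (toℕ<n ℓ′)) (+-monoʳ-≤ E (Σoffsets≤ r j)) ⟩
    k′ * Z + (E + H * w)       ≡⟨ x∙yz≈xz∙y +-commutativeSemigroup (k′ * Z) E (H * w) ⟩
    k′ * Z + H * w + E         ≤⟨ +-monoˡ-≤ E (≤-trans (m≤n+m _ (k * H * U)) (room j)) ⟩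
    a j + E                    ≤⟨ +-monoʳ-≤ (a j) (m≤m+n E (Σoffsets r₀ j)) ⟩
    a j + (E + Σoffsets r₀ j)  ≡⟨ cong (a j +_) (Σfree≡ fzero r₀ j) ⟨
    a j + Σfree fzero r₀ j     ∎
    where open ≤-Reasoning

  closing-sum : ∀ ℓ′ r₀ r j → closing ℓ′ r₀ r j + Σfree (fsuc ℓ′) r j ≡ a j + Σfree fzero r₀ j
  closing-sum ℓ′ r₀ r j = m∸n+n≡m (Σfree≤ ℓ′ r₀ r j)

  closing-balance : ∀ ℓ′ r₀ r j →
                    closing ℓ′ r₀ r j + toℕ (fsuc ℓ′) * Z + Σoffsets r j ≡ a j + Σoffsets r₀ j
  closing-balance ℓ′ r₀ r j = +-cancelʳ-≡ E _ _ (begin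
    c + l * Z + S + E        ≡⟨ reassoc c (l * Z) S E ⟩
    c + (l * Z + (E + S))    ≡⟨ cong (c +_) (Σfree≡ (fsuc ℓ′) r j) ⟨
    c + Σfree (fsuc ℓ′) r j  ≡⟨ closing-sum ℓ′ r₀ r j ⟩
    a j + Σfree fzero r₀ j   ≡⟨ cong (a j +_) (Σfree≡ fzero r₀ j) ⟩
    a j + (E + S₀)           ≡⟨ x∙yz≈xz∙y +-commutativeSemigroup (a j) E S₀ ⟩
    a j + S₀ + E             ∎)
    where
    open ≡-Reasoning
    c = closing ℓ′ r₀ r j
    l = toℕ (fsuc ℓ′)
    S = Σoffsets r j
    S₀ = Σoffsets r₀ j
    reassoc : ∀ c m t e → c + m + t + e ≡ c + (m + (e + t))
    reassoc = solve-∀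

  closing<a : ∀ ℓ′ r₀ r j → closing ℓ′ r₀ r j < a j
  closing<a ℓ′ r₀ r j = +-cancelʳ-< Z c (a j) (begin-strict
    c + Z                        ≤⟨ +-monoʳ-≤ c (m≤n*m Z (toℕ (fsuc ℓ′))) ⟩
    c + toℕ (fsuc ℓ′) * Z        ≤⟨ m≤m+n _ (Σoffsets r j) ⟩
    c + toℕ (fsuc ℓ′) * Z + Σoffsets r j
                                 ≡⟨ closing-balance ℓ′ r₀ r j ⟩
    a j + Σoffsets r₀ j          <⟨ +-monoʳ-< (a j) (≤-<-trans (Σoffsets≤ r₀ j) Hw<Z) ⟩
    a j + Z                      ∎)
    where
    open ≤-Reasoning
    c = closing ℓ′ r₀ r j

  closing<n : ∀ ℓ′ r₀ r j → closing ℓ′ r₀ r j < n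
  closing<n ℓ′ r₀ r j = <-trans (closing<a ℓ′ r₀ r j) (a<n j)

  toPoint∘free-injective : ∀ ℓ i → Injective _≡_ _≡_ (λ t → toPoint (free ℓ i t))
  toPoint∘free-injective ℓ i {t} {t′} eq = Pointwise-≡⇒≡ (ext λ j → free-injective ℓ i t t′ j
    (toPoint-injective (free ℓ i t) (free ℓ i t′) j (free<n ℓ i t j) (free<n ℓ i t′ j) eq))

  toPoint∘closing-injective : ∀ ℓ′ r₀ rest →
                              Injective _≡_ _≡_ (λ t → toPoint (closing ℓ′ r₀ (t ∷ rest)))
  toPoint∘closing-injective ℓ′ r₀ rest {t} {t′} eq = Pointwise-≡⇒≡ (ext λ j →
    free-injective (fsuc ℓ′) fzero t t′ j (+-cancelʳ-≡ (Σrest j) _ _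
      (∸-cancelˡ-≡ (Σfree≤ ℓ′ r₀ (t ∷ rest) j) (Σfree≤ ℓ′ r₀ (t′ ∷ rest) j)
        (toPoint-injective (closing ℓ′ r₀ (t ∷ rest)) (closing ℓ′ r₀ (t′ ∷ rest)) j
          (closing<n ℓ′ r₀ (t ∷ rest) j) (closing<n ℓ′ r₀ (t′ ∷ rest) j) eq))))
    where
    Σrest : Fin d → ℕ
    Σrest j = ∑ (λ i → free (fsuc ℓ′) (fsuc i) (lookup rest i) j)

  data Slot (j : Fin d) (ℓ : Fin k) (y : ℕ) : Fin h → Set where
    firstSlot : ∀ {s t} → s ≤ H * w → t ≤ H * w → y + toℕ ℓ * Z + t ≡ a j + s → Slot j ℓ y fzero
    freeSlot  : ∀ {i t} → t < U → y ≡ toℕ (combine ℓ i) * U + t → Slot j ℓ y (fsuc i)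

  freeSlot-below : ∀ {j ℓ ℓ′ y i} → Slot j ℓ y (fsuc i) → ¬ Slot j ℓ′ y fzero
  freeSlot-below {j} {ℓ} {ℓ′} {y} {i} (freeSlot t<U refl) (firstSlot {s} {t′} _ t′≤ eq) =
    <-irrefl refl (begin-strict
      a j                           ≤⟨ m≤m+n (a j) s ⟩
      a j + s                       ≡⟨ eq ⟨
      y + toℕ ℓ′ * Z + t′           ≡⟨ +-assoc y (toℕ ℓ′ * Z) t′ ⟩
      y + (toℕ ℓ′ * Z + t′)         <⟨ +-mono-<-≤ (m*n+o<p*n (toℕ<n (combine ℓ i)) t<U)
                                         (+-mono-≤ (*-monoˡ-≤ Z (s≤s⁻¹ (toℕ<n ℓ′))) t′≤) ⟩
      k * H * U + (k′ * Z + H * w)  ≤⟨ room j ⟩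
      a j                           ∎)
    where open ≤-Reasoning

  slot-unique : ∀ {j ℓ ℓ′ y i i′} → Slot j ℓ y i → Slot j ℓ′ y i′ → ℓ ≡ ℓ′ × i ≡ i′
  slot-unique {ℓ = ℓ} {ℓ′} {i = fsuc i} {fsuc i′} (freeSlot t<U refl) (freeSlot t′<U eq)
    with combine-injective ℓ i ℓ′ i′ (toℕ-injective (m*n+o≡p*n+q⇒m≡p t<U t′<U eq))
  ... | refl , refl = refl , refl
  slot-unique {j} {ℓ} {ℓ′} {y} (firstSlot {s} {t} s≤ t≤ eq) (firstSlot {s′} {t′} s′≤ t′≤ eq′) =
    toℕ-injective (m*n+o≡p*n+q⇒m≡p (small t≤ s′≤) (small t′≤ s≤)
      (+-cancel-cross y (a j) (toℕ ℓ * Z) (toℕ ℓ′ * Z) t t′ s s′ eq eq′)) , refl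
    where
    small : ∀ {t s} → t ≤ H * w → s ≤ H * w → t + s < Z
    small t≤ s≤ = ≤-<-trans (+-mono-≤ t≤ s≤) 2Hw<Z
  slot-unique free@(freeSlot _ _) first@(firstSlot _ _ _) = contradiction first (freeSlot-below free)
  slot-unique first@(firstSlot _ _ _) free@(freeSlot _ _) = contradiction first (freeSlot-below free)

  rowCoords : Row → Fin k → Row → Fin h → Fin d → ℕ
  rowCoords r₀ ℓ         r (fsuc i) = free ℓ i (lookup r i)
  rowCoords r₀ fzero     r fzero    = a
  rowCoords r₀ (fsuc ℓ′) r fzero    = closing ℓ′ r₀ r

  coords : Cfg → Fin k → Fin h → Fin d → ℕ
  coords P ℓ = rowCoords (lookup P fzero) ℓ (lookup P ℓ)

  labelling : Cfg → Fin k → Fin h → Point n d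
  labelling P ℓ i = toPoint (coords P ℓ i)

  coords-slot : ∀ P ℓ i j → Slot j ℓ (coords P ℓ i j) i
  coords-slot P ℓ         (fsuc i) j = freeSlot (offset<U (lookup (lookup P ℓ) i) j) refl
  coords-slot P fzero     fzero    j = firstSlot z≤n z≤n (+-identityʳ (a j + 0))
  coords-slot P (fsuc ℓ′) fzero    j =
    firstSlot (Σoffsets≤ (lookup P fzero) j) (Σoffsets≤ (lookup P (fsuc ℓ′)) j)
              (closing-balance ℓ′ (lookup P fzero) (lookup P (fsuc ℓ′)) j)

  coords<n : ∀ P ℓ i j → coords P ℓ i j < n
  coords<n P ℓ         (fsuc i) j = free<n ℓ i (lookup (lookup P ℓ) i) j
  coords<n P fzero     fzero    j = a<n j
  coords<n P (fsuc ℓ′) fzero    j = closing<n ℓ′ (lookup P fzero) (lookup P (fsuc ℓ′)) j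

  labelling-injective : ∀ P P′ {ℓ ℓ′ i i′} →
                        labelling P ℓ i ≡ labelling P′ ℓ′ i′ → ℓ ≡ ℓ′ × i ≡ i′
  labelling-injective P P′ {ℓ} {ℓ′} {i} {i′} eq = slot-unique (coords-slot P ℓ i fzero)
    (subst (λ y → Slot fzero ℓ′ y i′) (sym coords≡) (coords-slot P′ ℓ′ i′ fzero))
    where
    coords≡ : coords P ℓ i fzero ≡ coords P′ ℓ′ i′ fzero
    coords≡ = toPoint-injective (coords P ℓ i) (coords P′ ℓ′ i′) fzero
                (coords<n P ℓ i fzero) (coords<n P′ ℓ′ i′ fzero) eq

  labelling-first : ∀ P ℓ i → IsFirst ℓ i → labelling P ℓ i ≡ v
  labelling-first P fzero    fzero    _        = toPoint-a
  labelling-first P fzero    (fsuc i) (_ , ())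
  labelling-first P (fsuc ℓ) i        (() , _)

  labelling≢v : ∀ P ℓ i → ¬ IsFirst ℓ i → labelling P ℓ i ≢ v
  labelling≢v P ℓ i ¬first eq
    with labelling-injective P P {ℓ} {fzero} {i} {fzero} (trans eq (sym toPoint-a))
  ... | refl , refl = ¬first (refl , refl)

  ∑-coords : ∀ P ℓ j → ∑ (λ i → coords P ℓ i j) ≡ a j + Σfree fzero (lookup P fzero) j
  ∑-coords P fzero     j = refl
  ∑-coords P (fsuc ℓ′) j = closing-sum ℓ′ (lookup P fzero) (lookup P (fsuc ℓ′)) j

  rowSum-labelling : ∀ P ℓ ℓ′ j → rowSum (labelling P ℓ) j ≡ rowSum (labelling P ℓ′) j
  rowSum-labelling P ℓ ℓ′ j = begin
    rowSum (labelling P ℓ) j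
      ≡⟨ ∑-cong (λ i → toℕ-toPoint (coords P ℓ i) j (coords<n P ℓ i j)) ⟩
    ∑ (λ i → μ j (coords P ℓ i j))
      ≡⟨ ∑-mirror (orientation j) _ _ (bound ℓ) (bound ℓ′)
                  (trans (∑-coords P ℓ j) (sym (∑-coords P ℓ′ j))) ⟩
    ∑ (λ i → μ j (coords P ℓ′ i j))
      ≡⟨ ∑-cong (λ i → toℕ-toPoint (coords P ℓ′ i) j (coords<n P ℓ′ i j)) ⟨
    rowSum (labelling P ℓ′) j ∎
    where
    open ≡-Reasoning
    bound : ∀ ℓ i → coords P ℓ i j ≤ n₀
    bound ℓ i = s≤s⁻¹ (coords<n P ℓ i j)

  GoodSet-labelling : ∀ P → (∀ ℓ i → ¬ IsFirst ℓ i → T (A (labelling P ℓ i))) →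
                      GoodSet k h A v (nonFirstPoints (labelling P))
  GoodSet-labelling P inA =
    All.tabulate (λ p∈ → inA∧≢v (Equivalence.to (∈-nonFirstPoints (labelling P)) p∈)) ,
    labelling P ,
    labelling-first P ,
    (λ ℓ i ℓ′ i′ _ _ → labelling-injective P P {ℓ} {ℓ′} {i} {i′}) ,
    (λ p → ∈-nonFirstPoints (labelling P)) ,
    rowSum-labelling P
    where
    inA∧≢v : ∀ {p} → ∃[ ℓ ] ∃[ i ] (¬ IsFirst ℓ i × labelling P ℓ i ≡ p) → T (A p) × p ≢ v
    inA∧≢v (ℓ , i , ¬first , refl) = inA ℓ i ¬first , labelling≢v P ℓ i ¬first

  labelling-match : ∀ P P′ ℓ i →
    (∃[ ℓ′ ] ∃[ i′ ] (¬ IsFirst ℓ′ i′ × labelling P′ ℓ′ i′ ≡ labelling P ℓ i)) →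
    labelling P ℓ i ≡ labelling P′ ℓ i
  labelling-match P P′ ℓ i (ℓ′ , i′ , _ , eq) with labelling-injective P′ P {ℓ′} {ℓ} {i′} {i} eq
  ... | refl , refl = sym eq

  labelling-determines : ∀ P P′ →
    (∀ p → (p ∈ nonFirstPoints (labelling P)) ⇔ (p ∈ nonFirstPoints (labelling P′))) → P ≡ P′
  labelling-determines P P′ same = Pointwise-≡⇒≡ (ext λ ℓ →
    Pointwise-≡⇒≡ (ext λ i → toPoint∘free-injective ℓ i (same-free ℓ i)))
    where
    same-free : ∀ ℓ i → labelling P ℓ (fsuc i) ≡ labelling P′ ℓ (fsuc i)
    same-free ℓ i = labelling-match P P′ ℓ (fsuc i)
      (Equivalence.to (∈-nonFirstPoints (labelling P′)) (Equivalence.to (same _)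
        (Equivalence.from (∈-nonFirstPoints (labelling P)) (ℓ , fsuc i , (λ ()) ∘ proj₂ , refl))))

  freeChoices : Fin k → Fin H → List Box
  freeChoices ℓ i = filterᵇ (λ t → A (toPoint (free ℓ i t))) (allPoints w d)

  restChoices : Fin k′ → List (Vec Box H₀)
  restChoices ℓ′ = choices (λ i → freeChoices (fsuc ℓ′) (fsuc i))

  closingChoices : Fin k′ → Row → Vec Box H₀ → List Box
  closingChoices ℓ′ r₀ rest =
    filterᵇ (λ t → A (toPoint (closing ℓ′ r₀ (t ∷ rest)))) (freeChoices (fsuc ℓ′) fzero)

  rowChoices : Fin k′ → Row → List Row
  rowChoices ℓ′ r₀ =
    dependentProductWith (λ rest t → t ∷ rest) (restChoices ℓ′) (closingChoices ℓ′ r₀)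

  laterRowsChoices : Row → List (Vec Row k′)
  laterRowsChoices r₀ = choices (λ ℓ′ → rowChoices ℓ′ r₀)

  configurations : List Cfg
  configurations = dependentProductWith _∷_ (choices (freeChoices fzero)) laterRowsChoices

  ∈-freeChoices⁻ : ∀ ℓ i {t} → t ∈ freeChoices ℓ i → T (A (toPoint (free ℓ i t)))
  ∈-freeChoices⁻ ℓ i t∈ = proj₂ (∈-filter⁻ (T? ∘ A ∘ toPoint ∘ free ℓ i) {xs = allPoints w d} t∈)

  rowChoices-inA : ∀ {ℓ′ r₀ r} → r ∈ rowChoices ℓ′ r₀ →
                   ∀ i → T (A (toPoint (rowCoords r₀ (fsuc ℓ′) r i)))
  rowChoices-inA {ℓ′} {r₀} r∈ i
    with ∈-dependentProductWith⁻ (λ rest t → t ∷ rest) (restChoices ℓ′) (closingChoices ℓ′ r₀) r∈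
  ... | rest , t , rest∈ , t∈ , refl
    with ∈-filter⁻ (T? ∘ A ∘ toPoint ∘ closing ℓ′ r₀ ∘ (_∷ rest))
                   {xs = freeChoices (fsuc ℓ′) fzero} t∈
  ...   | t∈free , closing-inA with i
  ...     | fzero          = closing-inA
  ...     | fsuc fzero     = ∈-freeChoices⁻ (fsuc ℓ′) fzero t∈free
  ...     | fsuc (fsuc i′) = ∈-freeChoices⁻ (fsuc ℓ′) (fsuc i′)
                               (∈-choices⁻ (λ i → freeChoices (fsuc ℓ′) (fsuc i)) rest∈ i′)

  configurations-inA : ∀ {P} → P ∈ configurations → ∀ ℓ i → ¬ IsFirst ℓ i → T (A (labelling P ℓ i))
  configurations-inA P∈ ℓ i ¬first
    with ∈-dependentProductWith⁻ _∷_ (choices (freeChoices fzero)) laterRowsChoices P∈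
  ... | r₀ , rs , r₀∈ , rs∈ , refl with ℓ | i
  ...   | fzero   | fzero  = contradiction (refl , refl) ¬first
  ...   | fzero   | fsuc i = ∈-freeChoices⁻ fzero i (∈-choices⁻ (freeChoices fzero) r₀∈ i)
  ...   | fsuc ℓ′ | i      = rowChoices-inA (∈-choices⁻ (λ ℓ′ → rowChoices ℓ′ r₀) rs∈ ℓ′) i

  freeChoices⁺ : ∀ ℓ i → Unique (freeChoices ℓ i)
  freeChoices⁺ ℓ i = Unique.filter⁺ (T? ∘ A ∘ toPoint ∘ free ℓ i) (allPoints⁺ d)

  rowChoices⁺ : ∀ ℓ′ r₀ → Unique (rowChoices ℓ′ r₀)
  rowChoices⁺ ℓ′ r₀ = dependentProductWith⁺ (λ rest t → t ∷ rest) (swap ∘ ∷-injective)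
    (choices⁺ (λ i → freeChoices⁺ (fsuc ℓ′) (fsuc i)))
    (λ rest → Unique.filter⁺ (T? ∘ A ∘ toPoint ∘ closing ℓ′ r₀ ∘ (_∷ rest))
                             (freeChoices⁺ (fsuc ℓ′) fzero))

  configurations⁺ : Unique configurations
  configurations⁺ = dependentProductWith⁺ _∷_ ∷-injective
    (choices⁺ (freeChoices⁺ fzero)) (λ r₀ → choices⁺ (λ ℓ′ → rowChoices⁺ ℓ′ r₀))

  L : ℕ
  L = w ^ d ∸ (missing A + missing A)

  length-freeChoices : ∀ ℓ i → w ^ d ∸ missing A ≤ length (freeChoices ℓ i)
  length-freeChoices ℓ i =
    subst (λ m → m ∸ missing A ≤ length (freeChoices ℓ i)) (length-allPoints w d)
      (length-filterᵇ-∘-injective A (toPoint∘free-injective ℓ i) (allPoints⁺ d))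

  L≤length-freeChoices : ∀ ℓ i → L ≤ length (freeChoices ℓ i)
  L≤length-freeChoices ℓ i =
    ≤-trans (∸-monoʳ-≤ (w ^ d) (m≤m+n (missing A) (missing A))) (length-freeChoices ℓ i)

  L≤length-closingChoices : ∀ ℓ′ r₀ rest → L ≤ length (closingChoices ℓ′ r₀ rest)
  L≤length-closingChoices ℓ′ r₀ rest = begin
    w ^ d ∸ (missing A + missing A)
      ≡⟨ ∸-+-assoc (w ^ d) (missing A) (missing A) ⟨
    w ^ d ∸ missing A ∸ missing A
      ≤⟨ ∸-monoˡ-≤ (missing A) (length-freeChoices (fsuc ℓ′) fzero) ⟩
    length (freeChoices (fsuc ℓ′) fzero) ∸ missing A
      ≤⟨ length-filterᵇ-∘-injective A (toPoint∘closing-injective ℓ′ r₀ rest)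
           (freeChoices⁺ (fsuc ℓ′) fzero) ⟩
    length (closingChoices ℓ′ r₀ rest) ∎
    where open ≤-Reasoning

  L^H≤length-rowChoices : ∀ ℓ′ r₀ → L ^ H ≤ length (rowChoices ℓ′ r₀)
  L^H≤length-rowChoices ℓ′ r₀ = begin
    L * L ^ H₀
      ≡⟨ *-comm L (L ^ H₀) ⟩
    L ^ H₀ * L
      ≤⟨ *-monoˡ-≤ L (length-choices-≥ _ (L≤length-freeChoices (fsuc ℓ′) ∘ fsuc)) ⟩
    length (restChoices ℓ′) * L
      ≤⟨ length-dependentProductWith-≥ (λ rest t → t ∷ rest) (restChoices ℓ′) (closingChoices ℓ′ r₀)
           (λ {rest} _ → L≤length-closingChoices ℓ′ r₀ rest) ⟩
    length (rowChoices ℓ′ r₀) ∎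
    where open ≤-Reasoning

  [L^H]^k≤length-configurations : (L ^ H) ^ k ≤ length configurations
  [L^H]^k≤length-configurations = begin
    L ^ H * (L ^ H) ^ k′
      ≤⟨ *-monoˡ-≤ _ (length-choices-≥ (freeChoices fzero) (L≤length-freeChoices fzero)) ⟩
    length (choices (freeChoices fzero)) * (L ^ H) ^ k′
      ≤⟨ length-dependentProductWith-≥ _∷_ (choices (freeChoices fzero)) laterRowsChoices
           (λ {r₀} _ → length-choices-≥ (λ ℓ′ → rowChoices ℓ′ r₀)
                                        (λ ℓ′ → L^H≤length-rowChoices ℓ′ r₀)) ⟩
    length configurations ∎
    where open ≤-Reasoning

  fAtLeast-configurations : fAtLeast k h A v ((L ^ H) ^ k)
  fAtLeast-configurations =
    map (nonFirstPoints ∘ labelling) configurations ,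
    All.map⁺ (All.tabulate λ {P} P∈ → GoodSet-labelling P (configurations-inA P∈)) ,
    AllPairs.map⁺ (AllPairs.map (λ {P} {P′} P≢P′ same → P≢P′ (labelling-determines P P′ same))
                                configurations⁺) ,
    ≤-trans [L^H]^k≤length-configurations (≤-reflexive (sym (length-map _ configurations)))

-- Choice of scale

fAtLeast-box : ∀ {n d k′ H₀ w} (A : SubsetOf n d) (v : Point n d) → 1 ≤ d → 1 ≤ w →
               w * layoutFactor (suc k′) (suc H₀) ≤ n →
               fAtLeast (suc k′) (suc (suc H₀)) A v (((w ^ d ∸ (missing A + missing A)) ^ suc H₀) ^ suc k′)
fAtLeast-box {zero}   A v _ 1≤w w*K≤0 =
  contradiction w*K≤0 (<⇒≱ (*-mono-≤ {1} {_} {1} 1≤w (s≤s z≤n)))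
fAtLeast-box {suc n₀} {suc d₀} A v _ 1≤w w*K≤n = Construction.fAtLeast-configurations A v 1≤w w*K≤n

count-at-scale : ∀ {n d k′ H₀} (A : SubsetOf n d) (v : Point n d) → 1 ≤ d →
  let k = suc k′; H = suc H₀; K = layoutFactor k H; Q = (2 * K) ^ d in
  K ≤ n → 4 * Q * (n ^ d ∸ card A) ≤ n ^ d →
  ∃[ m ] (fAtLeast k (suc H) A v m × n ^ (d * k * H) ≤ (Q * 2) ^ (k * H) * m)
count-at-scale {n} {d} {k′} {H₀} A v 1≤d K≤n few-missing =
  (L ^ H) ^ k , fAtLeast-box A v 1≤d (m≥n⇒m/n>0 K≤n) (m/n*n≤m n K) , (begin
    n ^ (d * k * H)                  ≡⟨ cong (n ^_) (*-assoc d k H) ⟩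
    n ^ (d * (k * H))                ≡⟨ ^-*-assoc n d (k * H) ⟨
    (n ^ d) ^ (k * H)                ≤⟨ power-bound {M = missing A} {Q} (k * H) nᵈ≤Qwᵈ 4M≤wᵈ ⟩
    (Q * 2) ^ (k * H) * L ^ (k * H)  ≡⟨ cong (λ e → (Q * 2) ^ (k * H) * L ^ e) (*-comm k H) ⟩
    (Q * 2) ^ (k * H) * L ^ (H * k)  ≡⟨ cong ((Q * 2) ^ (k * H) *_) (^-*-assoc L H k) ⟨
    (Q * 2) ^ (k * H) * (L ^ H) ^ k  ∎)
  where
  open ≤-Reasoning
  k H K Q w L : ℕ
  k = suc k′
  H = suc H₀
  K = layoutFactor k H
  Q = (2 * K) ^ d
  w = n / K
  L = w ^ d ∸ (missing A + missing A)
  nᵈ≤Qwᵈ : n ^ d ≤ Q * w ^ d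
  nᵈ≤Qwᵈ = ≤-trans (^-monoˡ-≤ d (n≤m⇒m≤2*n*[m/n] n K K≤n))
                   (≤-reflexive (^-distribʳ-* (2 * K) w d))
  4M≤wᵈ : 4 * missing A ≤ w ^ d
  4M≤wᵈ = *-cancelˡ-≤ Q {{>-nonZero (m^n>0 (2 * K) d)}} (begin
    Q * (4 * missing A)       ≡⟨ x∙yz≈y∙xz *-commutativeSemigroup Q 4 (missing A) ⟩
    4 * (Q * missing A)       ≡⟨ *-assoc 4 Q (missing A) ⟨
    4 * Q * missing A         ≡⟨ cong (4 * Q *_) (missing≡ A) ⟩
    4 * Q * (n ^ d ∸ card A)  ≤⟨ few-missing ⟩
    n ^ d                     ≤⟨ nᵈ≤Qwᵈ ⟩
    Q * w ^ d                 ∎)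

corollary3p4 : ∀ (d k h : ℕ) → 1 ≤ d → 2 ≤ k → 2 ≤ h →
    ∃[ C ] (1 ≤ C ×
      (∀ (A : (n : ℕ) → SubsetOf n d) → AlmostFull d A →
        ∃[ N ] ∀ (n : ℕ) → N ≤ n → ∀ (v : Point n d) → T (A n v) →
          ∃[ m ] (fAtLeast k h (A n) v m × n ^ (d * k * (h ∸ 1)) ≤ C * m)))
corollary3p4 d k@(suc (suc _)) (suc H@(suc _)) 1≤d (s≤s (s≤s z≤n)) (s≤s (s≤s z≤n)) =
  (Q * 2) ^ (k * H) , m^n>0 (Q * 2) {{>-nonZero (*-mono-≤ 1≤Q (s≤s z≤n))}} (k * H) , eventually
  where
  K Q : ℕ
  K = layoutFactor k H
  Q = (2 * K) ^ d
  1≤Q : 1 ≤ Q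
  1≤Q = m^n>0 (2 * K) d
  eventually : ∀ A → AlmostFull d A → ∃[ N ] ∀ n → N ≤ n → ∀ (v : Point n d) → T (A n v) →
               ∃[ m ] (fAtLeast k (suc H) (A n) v m × n ^ (d * k * H) ≤ (Q * 2) ^ (k * H) * m)
  eventually A almostFull with almostFull (4 * Q) (*-mono-≤ {1} {4} (s≤s z≤n) 1≤Q)
  ... | N , few-missing = K + N , λ n K+N≤n v _ →
    count-at-scale (A n) v 1≤d (≤-trans (m≤m+n K N) K+N≤n) (few-missing n (≤-trans (m≤n+m N K) K+N≤n))
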